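{- Let $n\ge1$ and $m>2^n$ be integers. Kronecker holds a list of $m$ vectors $v_1,\ldots,v_m\in\{0,1\}^n$; Cantor adaptively queries entries ``bit $j$ of vector $i$'', and his goal is to determine whether $\{v_1,\ldots,v_m\}\supseteq\{0,1\}^n$. Suppose Kronecker answers according to the ``0 first'' strategy (defined in the context). Then for every (adaptive) strategy of Cantor, Cantor must make all $mn$ queries in order to determine whether the list contains every vector of $\{0,1\}^n$; that is, after any fewer than $mn$ queries, the answers given so far are consistent both with a list containing all of $\{0,1\}^n$ and with a list not containing all of $\{0,1\}^n$.
   Context: The state of the game is an $m\times n$ matrix $L$ with entries in $\{0,1,\star\}$, where $L(i,j)=\star$ means bit $j$ of $v_i$ has not been queried yet and otherwise $L(i,j)$ is Kronecker's answer; initially all entries are $\star$, and each query is to an entry currently equal to $\star$. Row $i$ of $L$ is denoted $L(i)$. A set $S$ of $2^n$ rows of $L$ is useful if, after replacing each $\star$ in the rows of $S$ by $0$ or $1$ suitably, the rows of $S$ are exactly the $2^n$ distinct vectors of $\{0,1\}^n$. $L$ is unblocked if it has a useful set of rows, and blocked otherwise. The ``0 first'' strategy of Kronecker: when Cantor queries entry $(i,j)$, Kronecker answers $1$ if setting $L(i,j)$ to $0$ would make $L$ blocked, and answers $0$ otherwise. -}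

module Defs where

open import Data.Nat using (ℕ; suc; _^_)
open import Data.Fin using (Fin; _≟_)
open import Data.Fin.Subset using (Subset; _∈_; ∣_∣)
open import Data.Unit using (⊤)
open import Data.Bool using (Bool; true; false)
open import Data.Maybe using (Maybe; just; nothing)
open import Data.Product using (Σ; ∃; _×_; _,_)
open import Relation.Nullary using (¬_; yes; no)
open import Relation.Binary.PropositionalEquality using (_≡_; _≢_)

-- An entry of the game matrix: nothing = ★ (not yet queried), just b = answer b.
Entry : Set
Entry = Maybe Bool

State : ℕ → ℕ → Set
State m n = Fin m → Fin n → Entry

initial : ∀ {m n} → State m n
initial _ _ = nothing

set : ∀ {m n} → State m n → Fin m → Fin n → Bool → State m n
set L i j b i' j' with i ≟ i' | j ≟ j'
... | yes _ | yes _ = just b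
... | _     | _     = L i' j'

Agrees : Entry → Bool → Set
Agrees nothing  _ = ⊤
Agrees (just a) b = a ≡ b

Useful : ∀ {m n} → State m n → Subset m → Set
Useful {m} {n} L S =
  ∣ S ∣ ≡ 2 ^ n ×
  Σ (Fin m → Fin n → Bool) λ F →
    (∀ i → i ∈ S → ∀ j → Agrees (L i j) (F i j)) ×
    (∀ i i' → i ∈ S → i' ∈ S → i ≢ i' → ¬ (∀ j → F i j ≡ F i' j)) ×
    (∀ (w : Fin n → Bool) → ∃ λ i → i ∈ S × (∀ j → F i j ≡ w j))

Unblocked : ∀ {m n} → State m n → Set
Unblocked L = ∃ λ S → Useful L S

Blocked : ∀ {m n} → State m n → Set
Blocked L = ¬ Unblocked L

ZeroFirstAnswer : ∀ {m n} → State m n → Fin m → Fin n → Bool → Set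
ZeroFirstAnswer L i j true  = Blocked (set L i j false)
ZeroFirstAnswer L i j false = ¬ Blocked (set L i j false)

-- Reachable L k: L is the state after k queries by Cantor (any adaptive choice of
-- queries to ★ entries), each answered by Kronecker according to "0 first".
data Reachable {m n : ℕ} : State m n → ℕ → Set where
  start : Reachable initial 0
  step  : ∀ {L k} (i : Fin m) (j : Fin n) (b : Bool) →
          Reachable L k → L i j ≡ nothing → ZeroFirstAnswer L i j b →
          Reachable (set L i j b) (suc k)

ConsistentWith : ∀ {m n} → State m n → (Fin m → Fin n → Bool) → Set
ConsistentWith L v = ∀ i j → Agrees (L i j) (v i j)

ContainsAll : ∀ {m n} → (Fin m → Fin n → Bool) → Set
ContainsAll {m} {n} v = ∀ (w : Fin n → Bool) → ∃ λ i → ∀ j → v i j ≡ w j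

{-# OPTIONS --safe #-}
-- Along every play against the "0 first" strategy two invariants hold: the state is
-- unblocked, and every recorded 1 is forced, i.e. changing it to 0 would block the state.
-- Unblocked means exactly that some completion of L lists all of {0,1}^n; this is
-- decidable by finite search, which turns the (doubly negated) meaning of an answer 0 into
-- an actual completion. A forced 1 keeps the state unblocked, since every useful
-- completion must then put a 1 there; initially 2^n ≤ m rows suffice.
-- Conversely, while some entry (i,j) is unqueried the completion by zeros misses a
-- vector: otherwise row i with bit j set to 1 occurs as some row r, whose bit j is an
-- answered 1, and exchanging rows i and r gives a completion with that 1 turned into 0.
-- Counting unqueried entries shows that one remains after fewer than mn queries.
module Submission where

open import Defs
open import Data.Bool as Bool using (Bool; true; false)
open import Data.Fin using (Fin; zero; suc; toℕ; inject≤; finToFun; funToFin; combine; _≟_)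
open import Data.Fin.Permutation.Components using (transpose; transpose-inverse)
open import Data.Fin.Properties
  using (any?; all?; 2↔Bool; funToFin-finToFin; finToFun-funToFin; toℕ-injective; toℕ-fromℕ<;
         toℕ<n; toℕ-inject≤; punchInᵢ≢i; suc-injective; 0≢1+n)
open import Data.Fin.Subset using (Subset; _∈_; _∉_; ∣_∣; ⁅_⁆; _∪_; inside; outside; ⊥)
open import Data.Fin.Subset.Properties using (x∈⁅x⁆; x∈⁅y⁆⇒x≡y; x∈p∪q⁻; x∈p∪q⁺; ∪-identityˡ; ∣⊥∣≡0; ∉⊥)
open import Data.Maybe using (just; nothing; fromMaybe)
open import Data.Maybe.Properties using (≡-dec; just-injective)
open import Data.Nat using (ℕ; zero; suc; _+_; _*_; _^_; _≤_; _<_; NonZero)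
open import Data.Nat.DivMod using (_mod_; m<n⇒m%n≡m)
open import Data.Nat.Properties using (+-0-commutativeMonoid; +-suc; +-identityʳ; *-identityʳ; <-irrefl; <⇒≤; m^n≢0)
open import Data.Product using (Σ; ∃; ∃₂; _×_; _,_; proj₁; proj₂; map₁; map₂)
open import Data.Sum using (_⊎_; inj₁; inj₂)
open import Data.Unit using (tt)
open import Data.Vec.Base using (_∷_; here; there)
open import Data.Vec.Functional using (updateAt; removeAt)
open import Data.Vec.Functional.Properties using (updateAt-updates; updateAt-minimal)
open import Function using (_∘_; const; Inverse; Injection)
open import Function.Properties.Inverse using (↔⇒↣)
open import Function.Definitions using (Injective)
open import Level using (0ℓ)
open import Relation.Binary using (Rel; Symmetric; _Respects_)
open import Relation.Binary.PropositionalEquality using (_≡_; _≢_; _≗_; refl; sym; trans; cong; cong₂; subst; module ≡-Reasoning)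
open import Relation.Nullary using (¬_; Dec; yes; no; contradiction)
open import Relation.Nullary.Decidable using (map′; _×-dec_; decidable-stable)
open import Relation.Unary using (Pred; Decidable)

open import Algebra.Properties.CommutativeMonoid.Sum +-0-commutativeMonoid
  using (sum; sum-remove; sum-cong-≗; sum-replicate-zero)

private
  variable
    m n : ℕ

set-updates : (L : State m n) (i : Fin m) (j : Fin n) (b : Bool) → set L i j b i j ≡ just b
set-updates L i j b with i ≟ i | j ≟ j
... | yes _  | yes _  = refl
... | yes _  | no j≢j = contradiction refl j≢j
... | no i≢i | _      = contradiction refl i≢i

set-minimal : (L : State m n) {i i' : Fin m} {j j' : Fin n} (b : Bool) →
              i ≢ i' ⊎ j ≢ j' → set L i j b i' j' ≡ L i' j'
set-minimal L {i} {i'} {j} {j'} b elsewhere with i ≟ i' | j ≟ j' | elsewhere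
... | yes refl | yes refl | inj₁ i≢i = contradiction refl i≢i
... | yes refl | yes refl | inj₂ j≢j = contradiction refl j≢j
... | yes _    | no _     | _        = refl
... | no _     | _        | _        = refl

set-answered : (L : State m n) {i i' : Fin m} {j j' : Fin n} {a b : Bool} →
               set L i j b i' j' ≡ just a → (i ≡ i' × j ≡ j' × b ≡ a) ⊎ L i' j' ≡ just a
set-answered L {i} {i'} {j} {j'} e with i ≟ i' | j ≟ j'
... | yes i≡i' | yes j≡j' = inj₁ (i≡i' , j≡j' , just-injective e)
... | yes _    | no _     = inj₂ e
... | no _     | _        = inj₂ e

_⊑_ : State m n → State m n → Set
M ⊑ M' = ∀ i j {b} → M i j ≡ just b → M' i j ≡ just b

set-mono : {M M' : State m n} (i : Fin m) (j : Fin n) (b : Bool) → M ⊑ M' → set M i j b ⊑ set M' i j b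
set-mono i j b M⊑M' i' j' e with i ≟ i' | j ≟ j'
... | yes _ | yes _ = e
... | yes _ | no _  = M⊑M' i' j' e
... | no _  | _     = M⊑M' i' j' e

set-extends : (L : State m n) {i : Fin m} {j : Fin n} (b : Bool) → L i j ≡ nothing → L ⊑ set L i j b
set-extends L {i} {j} b Lij≡★ i' j' e with i ≟ i' | j ≟ j'
... | yes refl | yes refl = contradiction (trans (sym Lij≡★) e) λ ()
... | yes _    | no _     = e
... | no _     | _        = e

consistent-antitone : {M M' : State m n} {v : Fin m → Fin n → Bool} →
                      M ⊑ M' → ConsistentWith M' v → ConsistentWith M v
consistent-antitone {M = M} M⊑M' cons i j with M i j in Mij
... | nothing = tt
... | just a  = subst (λ e → Agrees e _) (M⊑M' i j Mij) (cons i j)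

consistent-set : {L : State m n} {v : Fin m → Fin n → Bool} {i : Fin m} {j : Fin n} {b : Bool} →
                 ConsistentWith L v → v i j ≡ b → ConsistentWith (set L i j b) v
consistent-set {i = i} {j} cons vij≡b i' j' with i ≟ i' | j ≟ j'
... | yes refl | yes refl = sym vij≡b
... | yes _    | no _     = cons i' j'
... | no _     | _        = cons i' j'

Completable : State m n → Set
Completable {m} {n} L = Σ (Fin m → Fin n → Bool) λ v → ConsistentWith L v × ContainsAll v

completable-antitone : {M M' : State m n} → M ⊑ M' → Completable M' → Completable M
completable-antitone M⊑M' = map₂ (map₁ (consistent-antitone M⊑M'))

completion : (Fin m → Fin n → Bool) → State m n → Fin m → Fin n → Bool
completion F L i j = fromMaybe (F i j) (L i j)

completion-consistent : (F : Fin m → Fin n → Bool) (L : State m n) → ConsistentWith L (completion F L)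
completion-consistent F L i j with L i j
... | nothing = tt
... | just _  = refl

completion-agrees : {F : Fin m → Fin n → Bool} {L : State m n} {i : Fin m} {j : Fin n} →
                    Agrees (L i j) (F i j) → completion F L i j ≡ F i j
completion-agrees {F = F} {L} {i} {j} agree with L i j
... | nothing = refl
... | just _  = agree

binary : Fin (2 ^ n) → Fin n → Bool
binary c = Inverse.to 2↔Bool ∘ finToFun c

code : (Fin n → Bool) → Fin (2 ^ n)
code w = funToFin (Inverse.from 2↔Bool ∘ w)

binary-code : (w : Fin n → Bool) → binary (code w) ≗ w
binary-code w j = trans (cong (Inverse.to 2↔Bool) (finToFun-funToFin _ j)) (Inverse.strictlyInverseˡ 2↔Bool (w j))

funToFin-cong : {k l : ℕ} {f g : Fin k → Fin l} → f ≗ g → funToFin f ≡ funToFin g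
funToFin-cong {zero}  f≗g = refl
funToFin-cong {suc k} f≗g = cong₂ combine (f≗g zero) (funToFin-cong (f≗g ∘ suc))

binary-injective : {c c' : Fin (2 ^ n)} → binary {n} c ≗ binary c' → c ≡ c'
binary-injective {n} {c} {c'} same = begin
  c                                ≡⟨ funToFin-finToFin {n} c ⟨
  funToFin {n} (finToFun {2} c)    ≡⟨ funToFin-cong (λ j → Injection.injective (↔⇒↣ 2↔Bool) (same j)) ⟩
  funToFin {n} (finToFun {2} c')   ≡⟨ funToFin-finToFin {n} c' ⟩
  c'                               ∎
  where open ≡-Reasoning

-- Functions are enumerated only up to pointwise equality (there is no function
-- extensionality), hence the respect hypothesis on P.
module _ {A : Set} (_≈_ : Rel A 0ℓ) (≈-sym : Symmetric _≈_)
         {k : ℕ} (enum : Fin k → A) (enum-onto : ∀ a → ∃ λ c → enum c ≈ a)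
         {P : Pred A 0ℓ} (P-resp : P Respects _≈_) (P? : Decidable P) where

  ∃-enumerated? : Dec (∃ P)
  ∃-enumerated? = map′ (λ (c , Pc) → enum c , Pc) from-witness (any? (P? ∘ enum))
    where
    from-witness : ∃ P → ∃ (P ∘ enum)
    from-witness (a , Pa) = map₂ (λ enum-c≈a → P-resp (≈-sym enum-c≈a) Pa) (enum-onto a)

  ∀-enumerated? : Dec (∀ a → P a)
  ∀-enumerated? = map′ to-all (λ all c → all (enum c)) (all? (P? ∘ enum))
    where
    to-all : (∀ c → P (enum c)) → ∀ a → P a
    to-all all a = let (c , enum-c≈a) = enum-onto a in P-resp enum-c≈a (all c)

agrees? : ∀ e b → Dec (Agrees e b)
agrees? nothing  b = yes tt
agrees? (just a) b = a Bool.≟ b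

containsAll? : (v : Fin m → Fin n → Bool) → Dec (ContainsAll v)
containsAll? v = ∀-enumerated? _≗_ (sym ∘_) binary (λ w → code w , binary-code w) occurs-resp
                   (λ w → any? λ i → all? λ j → v i j Bool.≟ w j)
  where
  occurs-resp : (λ w → ∃ λ i → v i ≗ w) Respects _≗_
  occurs-resp w≗w' = map₂ λ vi≗w j → trans (vi≗w j) (w≗w' j)

completable? : (L : State m n) → Dec (Completable L)
completable? {m} {n} L = ∃-enumerated? _≋_ (λ v≋v' i j → sym (v≋v' i j)) matrix matrix-onto completable-resp
                           (λ v → (all? λ i → all? λ j → agrees? (L i j) (v i j)) ×-dec containsAll? v)
  where
  _≋_ : Rel (Fin m → Fin n → Bool) 0ℓ
  v ≋ v' = ∀ i → v i ≗ v' i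

  matrix : Fin ((2 ^ n) ^ m) → Fin m → Fin n → Bool
  matrix c i = binary (finToFun c i)

  matrix-onto : ∀ v → ∃ λ c → matrix c ≋ v
  matrix-onto v = funToFin (code ∘ v) , λ i j →
    trans (cong (λ c → binary c j) (finToFun-funToFin (code ∘ v) i)) (binary-code (v i) j)

  completable-resp : (λ v → ConsistentWith L v × ContainsAll v) Respects _≋_
  completable-resp v≋v' (cons , covers) =
    (λ i j → subst (Agrees (L i j)) (v≋v' i j) (cons i j)) ,
    (λ w → map₂ (λ {i} vi≗w j → trans (sym (v≋v' i j)) (vi≗w j)) (covers w))

∣⁅x⁆∪p∣≡1+∣p∣ : {x : Fin m} {p : Subset m} → x ∉ p → ∣ ⁅ x ⁆ ∪ p ∣ ≡ suc ∣ p ∣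
∣⁅x⁆∪p∣≡1+∣p∣ {x = zero}  {outside ∷ p} x∉p = cong (suc ∘ ∣_∣) (∪-identityˡ p)
∣⁅x⁆∪p∣≡1+∣p∣ {x = zero}  {inside ∷ p}  x∉p = contradiction here x∉p
∣⁅x⁆∪p∣≡1+∣p∣ {x = suc x} {outside ∷ p} x∉p = ∣⁅x⁆∪p∣≡1+∣p∣ (x∉p ∘ there)
∣⁅x⁆∪p∣≡1+∣p∣ {x = suc x} {inside ∷ p}  x∉p = cong suc (∣⁅x⁆∪p∣≡1+∣p∣ (x∉p ∘ there))

image : {k : ℕ} → (Fin k → Fin m) → Subset m
image {k = zero}  f = ⊥
image {k = suc k} f = ⁅ f zero ⁆ ∪ image (f ∘ suc)

∈-image⁺ : {k : ℕ} (f : Fin k → Fin m) (a : Fin k) → f a ∈ image f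
∈-image⁺ f zero    = x∈p∪q⁺ (inj₁ (x∈⁅x⁆ (f zero)))
∈-image⁺ f (suc a) = x∈p∪q⁺ (inj₂ (∈-image⁺ (f ∘ suc) a))

∈-image⁻ : {k : ℕ} (f : Fin k → Fin m) {x : Fin m} → x ∈ image f → ∃ λ a → f a ≡ x
∈-image⁻ {k = zero}  f x∈ = contradiction x∈ ∉⊥
∈-image⁻ {k = suc k} f x∈ with x∈p∪q⁻ ⁅ f zero ⁆ (image (f ∘ suc)) x∈
... | inj₁ x∈⁅f0⁆ = zero , sym (x∈⁅y⁆⇒x≡y (f zero) x∈⁅f0⁆)
... | inj₂ x∈rest = let (a , fa≡x) = ∈-image⁻ (f ∘ suc) x∈rest in suc a , fa≡x

∣image∣ : {k : ℕ} {f : Fin k → Fin m} → Injective _≡_ _≡_ f → ∣ image f ∣ ≡ k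
∣image∣ {m} {k = zero}  f-inj = ∣⊥∣≡0 m
∣image∣ {k = suc k} {f} f-inj = trans (∣⁅x⁆∪p∣≡1+∣p∣ f0∉rest) (cong suc (∣image∣ (suc-injective ∘ f-inj)))
  where
  f0∉rest : f zero ∉ image (f ∘ suc)
  f0∉rest f0∈rest = let (a , fa≡f0) = ∈-image⁻ (f ∘ suc) f0∈rest in 0≢1+n (f-inj (sym fa≡f0))

unblocked⇒completable : {L : State m n} → Unblocked L → Completable L
unblocked⇒completable {L = L} (S , _ , F , agree , _ , covers) =
  completion F L , completion-consistent F L ,
  λ w → let (i , i∈S , Fi≗w) = covers w in i , λ j → trans (completion-agrees {F = F} {L} (agree i i∈S j)) (Fi≗w j)

completable⇒unblocked : {L : State m n} → Completable L → Unblocked L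
completable⇒unblocked {m} {n} (v , cons , covers) =
  image row , ∣image∣ row-injective , v , (λ i _ → cons i) , distinct ,
  λ w → row (code w) , ∈-image⁺ row (code w) , λ j → trans (row-binary (code w) j) (binary-code w j)
  where
  row : Fin (2 ^ n) → Fin m
  row c = proj₁ (covers (binary c))

  row-binary : ∀ c → v (row c) ≗ binary c
  row-binary c = proj₂ (covers (binary c))

  same-row : ∀ {c c'} → v (row c) ≗ v (row c') → c ≡ c'
  same-row {c} {c'} same = binary-injective λ j → trans (sym (row-binary c j)) (trans (same j) (row-binary c' j))

  row-injective : Injective _≡_ _≡_ row
  row-injective rc≡rc' = same-row λ j → cong (λ i → v i j) rc≡rc'

  distinct : ∀ i i' → i ∈ image row → i' ∈ image row → i ≢ i' → ¬ (∀ j → v i j ≡ v i' j)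
  distinct i i' i∈ i'∈ i≢i' same with ∈-image⁻ row i∈ | ∈-image⁻ row i'∈
  ... | c , refl | c' , refl = i≢i' (cong row (same-row same))

toℕ-mod : {k : ℕ} .{{_ : NonZero k}} (c : Fin k) → toℕ c mod k ≡ c
toℕ-mod c = toℕ-injective (trans (toℕ-fromℕ< _) (m<n⇒m%n≡m (toℕ<n c)))

initial-completable : 2 ^ n ≤ m → Completable (initial {m} {n})
initial-completable {n} {m} 2ⁿ≤m = v , (λ _ _ → tt) , λ w → inject≤ (code w) 2ⁿ≤m , λ j →
  trans (cong (λ c → binary c j) (v-inject≤ (code w))) (binary-code w j)
  where
  instance
    2ⁿ≢0 : NonZero (2 ^ n)
    2ⁿ≢0 = m^n≢0 2 n

  v : Fin m → Fin n → Bool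
  v i = binary (toℕ i mod 2 ^ n)

  v-inject≤ : ∀ c → toℕ (inject≤ c 2ⁿ≤m) mod 2 ^ n ≡ c
  v-inject≤ c = trans (cong (_mod 2 ^ n) (toℕ-inject≤ c 2ⁿ≤m)) (toℕ-mod c)

sum-const : (k c : ℕ) → sum {k} (const c) ≡ k * c
sum-const zero    c = refl
sum-const (suc k) c = cong (c +_) (sum-const k c)

sum-decrement : {k : ℕ} (f g : Fin k → ℕ) (i : Fin k) →
                f i ≡ suc (g i) → (∀ a → a ≢ i → f a ≡ g a) → sum f ≡ suc (sum g)
sum-decrement {suc k} f g i fi≡1+gi f≡g-elsewhere = begin
  sum f                          ≡⟨ sum-remove f ⟩
  f i + sum (removeAt f i)       ≡⟨ cong₂ _+_ fi≡1+gi (sum-cong-≗ λ a → f≡g-elsewhere _ (punchInᵢ≢i i a)) ⟩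
  suc (g i + sum (removeAt g i)) ≡⟨ cong suc (sum-remove g) ⟨
  suc (sum g)                    ∎
  where open ≡-Reasoning

blank : Entry → ℕ
blank nothing  = 1
blank (just _) = 0

blanks : State m n → ℕ
blanks L = sum λ i → sum λ j → blank (L i j)

blanks-initial : blanks (initial {m} {n}) ≡ m * n
blanks-initial {m} {n} = trans (sum-cong-≗ {m} λ _ → trans (sum-const n 1) (*-identityʳ n)) (sum-const m n)

blanks-set : (L : State m n) {i : Fin m} {j : Fin n} (b : Bool) →
             L i j ≡ nothing → blanks L ≡ suc (blanks (set L i j b))
blanks-set L {i} {j} b Lij≡★ = sum-decrement _ _ i
  (sum-decrement _ _ j (trans (cong blank Lij≡★) (cong (suc ∘ blank) (sym (set-updates L i j b)))) λ j' j'≢j →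
     cong blank (sym (set-minimal L {i} {i} b (inj₂ (j'≢j ∘ sym)))))
  λ i' i'≢i → sum-cong-≗ λ j' → cong blank (sym (set-minimal L {j = j} {j'} b (inj₁ (i'≢i ∘ sym))))

reachable-blanks : {L : State m n} {k : ℕ} → Reachable L k → k + blanks L ≡ m * n
reachable-blanks {m} {n} start = blanks-initial {m} {n}
reachable-blanks (step {L = L} {k} i j b R Lij≡★ _) = begin
  suc k + blanks (set L i j b)   ≡⟨ +-suc k _ ⟨
  k + suc (blanks (set L i j b)) ≡⟨ cong (k +_) (blanks-set L b Lij≡★) ⟨
  k + blanks L                   ≡⟨ reachable-blanks R ⟩
  _                              ∎
  where open ≡-Reasoning

blanks-≡0 : (L : State m n) → (∀ i j → L i j ≢ nothing) → blanks L ≡ 0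
blanks-≡0 {m} {n} L answered =
  trans (sum-cong-≗ λ i → trans (sum-cong-≗ λ j → blank-just (answered i j)) (sum-replicate-zero n))
        (sum-replicate-zero m)
  where
  blank-just : ∀ {e} → e ≢ nothing → blank e ≡ 0
  blank-just {nothing} e≢★ = contradiction refl e≢★
  blank-just {just _}  _   = refl

reachable-unanswered : {L : State m n} {k : ℕ} → Reachable L k → k < m * n → ∃₂ λ i j → L i j ≡ nothing
reachable-unanswered {L = L} {k} R k<mn =
  decidable-stable (any? λ i → any? λ j → ≡-dec Bool._≟_ (L i j) nothing) λ none →
    <-irrefl (begin
      k            ≡⟨ +-identityʳ k ⟨
      k + 0        ≡⟨ cong (k +_) (blanks-≡0 L λ i j Lij≡★ → none (i , j , Lij≡★)) ⟨
      k + blanks L ≡⟨ reachable-blanks R ⟩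
      _            ∎) k<mn
  where open ≡-Reasoning

transpose-rows : {v : Fin m → Fin n → Bool} {i r : Fin m} {b : Fin n} →
                 v i b ≡ v r b → ∀ a → v (transpose i r a) b ≡ v a b
transpose-rows {v = v} {i} {r} {b} vib≡vrb a with a ≟ i
... | yes refl = sym vib≡vrb
... | no _ with a ≟ r
...   | yes refl = vib≡vrb
...   | no _     = refl

containsAll-reindex : {v : Fin m → Fin n → Bool} (σ : Fin m → Fin m) → (∀ a → ∃ λ a' → σ a' ≡ a) →
                      ContainsAll v → ContainsAll (v ∘ σ)
containsAll-reindex {v = v} σ σ-onto covers w =
  let (a , va≗w) = covers w ; (a' , σa'≡a) = σ-onto a in
  a' , λ j → trans (cong (λ x → v x j) σa'≡a) (va≗w j)

swap-consistent : {L : State m n} {v : Fin m → Fin n → Bool} {i r : Fin m} {j : Fin n} →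
                  ConsistentWith L v → r ≢ i → L i j ≡ nothing → v i j ≡ false →
                  (∀ b → b ≢ j → v i b ≡ v r b) → ConsistentWith (set L r j false) (v ∘ transpose i r)
swap-consistent {L = L} {v} {i} {r} {j} cons r≢i Lij≡★ vij≡0 rows-agree a b with b ≟ j
... | no b≢j
  rewrite transpose-rows {v = v} (rows-agree b b≢j) a | set-minimal L {r} {a} {j} {b} false (inj₂ (b≢j ∘ sym))
  = cons a b
... | yes refl with a ≟ i
...   | yes refl rewrite set-minimal L {r} {i} {b} {b} false (inj₁ r≢i) | Lij≡★ = tt
...   | no _ with a ≟ r
...     | yes refl rewrite set-updates L r b false = sym vij≡0
...     | no a≢r rewrite set-minimal L {r} {a} {b} {b} false (inj₁ (a≢r ∘ sym)) = cons a b

zeroFilling : State m n → Fin m → Fin n → Bool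
zeroFilling = completion λ _ _ → false

OnesForced : State m n → Set
OnesForced L = ∀ i j → L i j ≡ just true → ¬ Completable (set L i j false)

zeroFilling-incomplete : {L : State m n} → OnesForced L → {i : Fin m} {j : Fin n} →
                         L i j ≡ nothing → ¬ ContainsAll (zeroFilling L)
zeroFilling-incomplete {m} {n} {L} forced {i} {j} Lij≡★ covers =
  forced r j Lrj≡1 (Z ∘ transpose i r ,
                    swap-consistent (completion-consistent _ L) r≢i Lij≡★ Zij≡0 rows-agree ,
                    containsAll-reindex (transpose i r) (λ a → transpose r i a , transpose-inverse i r) covers)
  where
  Z : Fin m → Fin n → Bool
  Z = zeroFilling L

  r : Fin m
  r = proj₁ (covers (updateAt (Z i) j (const true)))

  Zr≗Zi[j≔1] : Z r ≗ updateAt (Z i) j (const true)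
  Zr≗Zi[j≔1] = proj₂ (covers (updateAt (Z i) j (const true)))

  Zij≡0 : Z i j ≡ false
  Zij≡0 = cong (fromMaybe false) Lij≡★

  Lrj≡1 : L r j ≡ just true
  Lrj≡1 with L r j | trans (Zr≗Zi[j≔1] j) (updateAt-updates j (Z i))
  ... | just true  | _  = refl
  ... | just false | ()
  ... | nothing    | ()

  r≢i : r ≢ i
  r≢i r≡i = contradiction (trans (sym Lij≡★) (subst (λ x → L x j ≡ just true) r≡i Lrj≡1)) λ ()

  rows-agree : ∀ b → b ≢ j → Z i b ≡ Z r b
  rows-agree b b≢j = sym (trans (Zr≗Zi[j≔1] b) (updateAt-minimal b j (Z i) b≢j))

reachable-completable : 2 ^ n ≤ m → {L : State m n} {k : ℕ} → Reachable L k → Completable L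
reachable-completable 2ⁿ≤m start = initial-completable 2ⁿ≤m
reachable-completable _ (step {L = L} i j false _ _ not-blocked) =
  decidable-stable (completable? (set L i j false)) λ incompletable →
    not-blocked (incompletable ∘ unblocked⇒completable)
reachable-completable 2ⁿ≤m (step i j true R _ blocked) with reachable-completable 2ⁿ≤m R
... | v , cons , covers with v i j in vij
...   | true  = v , consistent-set cons vij , covers
...   | false = contradiction (completable⇒unblocked (v , consistent-set cons vij , covers)) blocked

reachable-onesForced : {L : State m n} {k : ℕ} → Reachable L k → OnesForced L
reachable-onesForced start _ _ ()
reachable-onesForced (step {L = L} i j b R Lij≡★ answer) r c L'rc≡1 completable
  with set-answered L {i} {r} {j} {c} {b = b} L'rc≡1
... | inj₂ Lrc≡1 =
  reachable-onesForced R r c Lrc≡1 (completable-antitone (set-mono r c false (set-extends L b Lij≡★)) completable)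
... | inj₁ (refl , refl , refl) =
  answer (completable⇒unblocked (completable-antitone (set-mono i j false (set-extends L true Lij≡★)) completable))

theorem4p5 : (m n : ℕ) → 1 ≤ n → 2 ^ n < m →
    (L : State m n) (k : ℕ) → Reachable L k → k < m * n →
      Σ (Fin m → Fin n → Bool) (λ v → ConsistentWith L v × ContainsAll v) ×
      Σ (Fin m → Fin n → Bool) (λ v → ConsistentWith L v × ¬ ContainsAll v)
theorem4p5 m n _ 2ⁿ<m L k R k<mn with reachable-unanswered R k<mn
... | _ , _ , Lij≡★ =
  reachable-completable (<⇒≤ 2ⁿ<m) R ,
  zeroFilling L , completion-consistent _ L , zeroFilling-incomplete (reachable-onesForced R) Lij≡★
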